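{- Let $\mathcal{H}$, $\mathscr{A}$, $\theta$, $\mathcal{H}_\theta$, $K_\theta$ and $\mathscr{A}_\theta$ be as in the context. Then $\mathscr{A}_\theta$ is faithful (injective) if and only if $\theta(\zeta_1)^2\neq\theta(\zeta_2)$. In this case $\mathscr{A}_\theta$ is an algebra isomorphism $$\mathcal{H}_\theta\xrightarrow{\ \simeq\ }\mathrm{End}_{\overline{\mathbb{F}}_q}(K_\theta).$$
   Context: Let $\overline{\mathbb{F}}_q$ be an algebraic closure of a finite field $\mathbb{F}_q$. Let $\mathcal{H}$ be the $\overline{\mathbb{F}}_q$-algebra generated by $S$, $U$, $U^{ -1}$ with relations $$UU^{ -1}=U^{ -1}U=1,\qquad S^2=-S,\qquad U^2S=SU^2.$$ Its center is $Z(\mathcal{H})=\overline{\mathbb{F}}_q[\zeta_1,\zeta_2^{\pm1}]$, where $$\zeta_1=US+U+SU,\qquad \zeta_2=U^2.$$ Let $P=\overline{\mathbb{F}}_q[e^{\pm\eta_1},e^{\pm\eta_2}]$, and let $s$ be the automorphism swapping $e^{\eta_1}$ and $e^{\eta_2}$. Then $P^s=\overline{\mathbb{F}}_q[\xi_1,\xi_2^{\pm1}]$, where $$\xi_1=e^{\eta_1}+e^{\eta_2},\qquad \xi_2=e^{\eta_1+\eta_2},$$ and $P$ is free over $P^s$ with basis $\{1,e^{ -\eta_1}\}$. (Geometrically, $P$ is the $GL_2$-equivariant $K$-theory of $\mathbb{P}^1$ with $\overline{\mathbb{F}}_q$-coefficients.) Let $D_s(a)=\dfrac{a-s(a)}{1-e^{\eta_1-\eta_2}}$.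 Let $\mathscr{A}:\mathcal{H}\to\mathrm{End}_{P^s}(P)$ be the algebra homomorphism with: - $\mathscr{A}(S)=-D_s$; - $\mathscr{A}(U)$ equal to the endomorphism whose matrix in the basis $\{1,e^{ -\eta_1}\}$ (columns giving the images) is $$\begin{pmatrix}\xi_1 & \xi_2^{ -1}\xi_1^2-1\\ -\xi_2 & -\xi_1\end{pmatrix}.$$ It satisfies $\mathscr{A}(\zeta_1)=\xi_1$ and $\mathscr{A}(\zeta_2)=\xi_2$. Let $\theta:Z(\mathcal{H})\to\overline{\mathbb{F}}_q$ be a ring homomorphism (a character). Set $$\mathcal{H}_\theta=\mathcal{H}\otimes_{Z(\mathcal{H}),\theta}\overline{\mathbb{F}}_q,\qquad K_\theta=P\otimes_{P^s}\overline{\mathbb{F}}_q,$$ where in $K_\theta$ the map $P^s\to\overline{\mathbb{F}}_q$ sends $\xi_i\mapsto\theta(\zeta_i)$. Let $\mathscr{A}_\theta:\mathcal{H}_\theta\to\mathrm{End}_{\overline{\mathbb{F}}_q}(K_\theta)$ be the induced homomorphism. -}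

module Defs where

open import Level using (_⊔_; suc)
open import Algebra.Bundles using (CommutativeRing)
open import Data.Nat as ℕ using (ℕ; zero; _^_; _≤_)
open import Data.Nat.Primality using (Prime)
open import Data.List using (List; []; _∷_; map)
open import Data.Product using (Σ; ∃; _×_; _,_)
open import Relation.Nullary using (¬_)
open import Relation.Binary.PropositionalEquality using (_≡_)

record Field c ℓ : Set (suc (c ⊔ ℓ)) where
  field
    commutativeRing : CommutativeRing c ℓ
  open CommutativeRing commutativeRing public
  field
    1≉0     : ¬ (1# ≈ 0#)
    inverse : ∀ x → ¬ (x ≈ 0#) → ∃ λ y → x * y ≈ 1#

module FieldNotions {c ℓ} (K : Field c ℓ) where
  open Field K using (Carrier; _≈_; _+_; _*_; -_; 0#; 1#)

  fromℕ : ℕ → Carrier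
  fromℕ zero = 0#
  fromℕ (ℕ.suc n) = 1# + fromℕ n

  horner : List Carrier → Carrier → Carrier
  horner [] x = 0#
  horner (a ∷ as) x = a + x * horner as x

  -- monic polynomial  a₀ + a₁ x + … + a_{n-1} x^{n-1} + x^n  (n = length as)
  evalMonic : List Carrier → Carrier → Carrier
  evalMonic [] x = 1#
  evalMonic (a ∷ as) x = a + x * evalMonic as x

  HasChar : ℕ → Set ℓ
  HasChar p = fromℕ p ≈ 0#

  AlgClosed : Set (c ⊔ ℓ)
  AlgClosed = ∀ (a : Carrier) (as : List Carrier) → ∃ λ x → evalMonic (a ∷ as) x ≈ 0#

  -- every element is algebraic over the prime field
  -- (root of a monic polynomial with coefficients in the prime subfield)
  AlgebraicOverPrimeField : Set (c ⊔ ℓ)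
  AlgebraicOverPrimeField = ∀ (x : Carrier) → ∃ λ (cs : List ℕ) → evalMonic (map fromℕ cs) x ≈ 0#

-- K is an algebraic closure of the finite field 𝔽_q :
-- q = p^r (p prime, r ≥ 1), char K = p, K algebraically closed and
-- algebraic over its prime subfield 𝔽_p ⊆ 𝔽_q.
record IsAlgClosureOfFq {c ℓ} (K : Field c ℓ) (q : ℕ) : Set (c ⊔ ℓ) where
  open FieldNotions K
  field
    p        : ℕ
    r        : ℕ
    p-prime  : Prime p
    r-pos    : 1 ≤ r
    q≡p^r    : q ≡ p ^ r
    char     : HasChar p
    closed   : AlgClosed
    algebraic : AlgebraicOverPrimeField

module Hecke {c ℓ} (K : Field c ℓ) where
  open Field K using (Carrier; _≈_; _+_; _*_; -_; 0#; 1#)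

  -- a character θ : Z(ℋ) = K[ζ₁, ζ₂^{±1}] → K (K-algebra homomorphism) is
  -- determined by θ(ζ₁) = t₁ and θ(ζ₂) = t₂, with t₂ invertible.
  record Character : Set (c ⊔ ℓ) where
    field
      t₁ t₂ t₂⁻¹ : Carrier
      t₂-inv     : t₂ * t₂⁻¹ ≈ 1#

  infixl 6 _⊕_
  infixl 7 _⊗_
  data Tm : Set c where
    gS gU gU⁻¹ : Tm
    sc         : Carrier → Tm
    _⊕_ _⊗_    : Tm → Tm → Tm

  ζ₁ ζ₂ : Tm
  ζ₁ = gU ⊗ gS ⊕ gU ⊕ gS ⊗ gU
  ζ₂ = gU ⊗ gU

  module _ (θ : Character) where
    open Character θ

    -- ℋ_θ = ℋ ⊗_{Z(ℋ),θ} K : the free K-algebra modulo the relations of ℋ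
    -- and ζ₁ = θ(ζ₁), ζ₂ = θ(ζ₂); _~_ is the generated congruence.
    infix 4 _~_
    data _~_ : Tm → Tm → Set (c ⊔ ℓ) where
      ~refl  : ∀ {x} → x ~ x
      ~sym   : ∀ {x y} → x ~ y → y ~ x
      ~trans : ∀ {x y z} → x ~ y → y ~ z → x ~ z
      ⊕-cong : ∀ {x x' y y'} → x ~ x' → y ~ y' → x ⊕ y ~ x' ⊕ y'
      ⊗-cong : ∀ {x x' y y'} → x ~ x' → y ~ y' → x ⊗ y ~ x' ⊗ y'
      sc-cong : ∀ {a b} → a ≈ b → sc a ~ sc b
      ⊕-assoc : ∀ x y z → (x ⊕ y) ⊕ z ~ x ⊕ (y ⊕ z)
      ⊕-comm  : ∀ x y → x ⊕ y ~ y ⊕ x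
      ⊕-idˡ   : ∀ x → sc 0# ⊕ x ~ x
      ⊕-invˡ  : ∀ x → sc (- 1#) ⊗ x ⊕ x ~ sc 0#
      ⊗-assoc : ∀ x y z → (x ⊗ y) ⊗ z ~ x ⊗ (y ⊗ z)
      ⊗-idˡ   : ∀ x → sc 1# ⊗ x ~ x
      ⊗-idʳ   : ∀ x → x ⊗ sc 1# ~ x
      ~distribˡ : ∀ x y z → x ⊗ (y ⊕ z) ~ x ⊗ y ⊕ x ⊗ z
      ~distribʳ : ∀ x y z → (y ⊕ z) ⊗ x ~ y ⊗ x ⊕ z ⊗ x
      sc-+    : ∀ a b → sc (a + b) ~ sc a ⊕ sc b
      sc-*    : ∀ a b → sc (a * b) ~ sc a ⊗ sc b
      sc-central : ∀ a x → sc a ⊗ x ~ x ⊗ sc a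
      UU⁻¹ : gU ⊗ gU⁻¹ ~ sc 1#
      U⁻¹U : gU⁻¹ ⊗ gU ~ sc 1#
      SS   : gS ⊗ gS ~ sc (- 1#) ⊗ gS
      UUS  : gU ⊗ gU ⊗ gS ~ gS ⊗ (gU ⊗ gU)
      θζ₁  : ζ₁ ~ sc t₁
      θζ₂  : ζ₂ ~ sc t₂

    -- End_K(K_θ) : K_θ has basis {1, e^{-η₁}}; an endomorphism is a 2×2
    -- matrix ( a b ; c d ) whose columns are the images of the basis.
    record Mat : Set c where
      constructor mat
      field a b c' d : Carrier

    _≈M_ : Mat → Mat → Set ℓ
    mat a b c' d ≈M mat a' b' c'' d' = (a ≈ a') × (b ≈ b') × (c' ≈ c'') × (d ≈ d')

    _+M_ _·M_ : Mat → Mat → Mat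
    mat a b c' d +M mat a' b' c'' d' = mat (a + a') (b + b') (c' + c'') (d + d')
    mat a b c' d ·M mat a' b' c'' d' =
      mat (a * a' + b * c'') (a * b' + b * d') (c' * a' + d * c'') (c' * b' + d * d')

    scalarM : Carrier → Mat
    scalarM x = mat x 0# 0# x

    -- 𝒜_θ(S) = - D_s  (D_s(1) = 0, D_s(e^{-η₁}) = e^{-η₁})
    AS : Mat
    AS = mat 0# 0# 0# (- 1#)

    -- 𝒜_θ(U), the given matrix with ξᵢ ↦ θ(ζᵢ)
    AU : Mat
    AU = mat t₁ (t₂⁻¹ * (t₁ * t₁) + - 1#) (- t₂) (- t₁)

    -- 𝒜_θ(U⁻¹) = 𝒜_θ(U)⁻¹
    AU⁻¹ : Mat
    AU⁻¹ = mat (t₂⁻¹ * t₁) (t₂⁻¹ * (t₂⁻¹ * (t₁ * t₁) + - 1#)) (- 1#) (- (t₂⁻¹ * t₁))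

    𝒜 : Tm → Mat
    𝒜 gS = AS
    𝒜 gU = AU
    𝒜 gU⁻¹ = AU⁻¹
    𝒜 (sc x) = scalarM x
    𝒜 (x ⊕ y) = 𝒜 x +M 𝒜 y
    𝒜 (x ⊗ y) = 𝒜 x ·M 𝒜 y

    Faithful : Set (c ⊔ ℓ)
    Faithful = ∀ x y → 𝒜 x ≈M 𝒜 y → x ~ y

    -- algebra isomorphism: well defined on ℋ_θ, injective and surjective
    -- (multiplicativity/additivity/unitality hold by definition of 𝒜)
    IsAlgebraIso : Set (c ⊔ ℓ)
    IsAlgebraIso =
      (∀ x y → x ~ y → 𝒜 x ≈M 𝒜 y) × Faithful × (∀ (M : Mat) → ∃ λ x → 𝒜 x ≈M M)

module Submission where

-- Write t₁ = θ(ζ₁), t₂ = θ(ζ₂); 𝒜_θ(U) is the traceless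
-- matrix (t₁ b𝒜 ; -t₂ -t₁) with b𝒜 = t₂⁻¹t₁² - 1, and b𝒜 = 0 iff t₁² = t₂.
--
-- * Matrix identities are proved by the ring solver, instantiated for any
--   commutative ring with integer coefficients (IntegerSolver) and lifted
--   entrywise to 2×2 matrices (Matrices).
-- * Any images of S, U, U⁻¹ satisfying the defining relations induce a map
--   constant on classes of ℋ_θ; every traceless U with U² = t₂ gives such
--   images (Representations).  This shows 𝒜_θ is well defined, and, for
--   t₁² = t₂, a second representation separates (1 + S)US from 0 although
--   𝒜_θ kills it, so 𝒜_θ is not faithful.
-- * If t₁² ≠ t₂, the idempotents e = 1 + S, f = -S satisfy eUe = t₁e,
--   fUf = -t₁f, eUfUe = (t₂ - t₁²)e, fUeUf = (t₂ - t₁²)f (HeckeCalculus), so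
--   e, κ·eUf, -t₂⁻¹·fUe, f (κ = b𝒜⁻¹) are matrix units in ℋ_θ sent to the
--   standard ones (MatrixUnits).  Their span inverts 𝒜_θ on both sides.

open import Defs
open import Data.Nat using (ℕ)
open import Data.Product using (_×_)
open import Function.Bundles using (_⇔_)
open import Relation.Nullary using (¬_)

open import Algebra.Bundles using (CommutativeRing)
open import Algebra.Solver.Ring.AlmostCommutativeRing
  using (fromCommutativeRing; _-Raw-AlmostCommutative⟶_)
open import Data.Nat as ℕ using (zero; suc)
import Data.Nat.Properties as ℕ
open import Data.Integer as ℤ using (ℤ; +_; -[1+_]; _⊖_; sign; ∣_∣; _◃_)
import Data.Integer.Properties as ℤ
open import Data.Sign as Sign using (Sign)
open import Data.Maybe using (Maybe; just; nothing)
open import Data.Product using (_,_; proj₁; proj₂; ∃)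
open import Data.List using (List; []; _∷_; _++_)
open import Data.Vec as Vec using (Vec; allFin)
open import Data.Vec.N-ary using (N-ary; _$ⁿ_; curryⁿ; Eq; Eqʰ; Eqʰ-to-Eq; curryⁿ-cong; curryⁿ-cong⁻¹)
open import Function.Bundles using (mk⇔)
open import Level using (_⊔_)
open import Relation.Nullary using (yes; no)
open import Relation.Binary.Bundles using (Setoid)
import Relation.Binary.PropositionalEquality as ≡
import Relation.Binary.Reasoning.Setoid as SetoidReasoning

-- Every commutative ring R receives a ring homomorphism from ℤ,
-- n ↦ n·1#.  With it, the standard library's ring solver normalises
-- polynomial identities over R with integer coefficients; integer
-- (rather than ℕ) coefficients are what lets it cancel terms x - x.
module IntegerSolver {c ℓ} (R : CommutativeRing c ℓ) where
  open CommutativeRing R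
  open import Algebra.Properties.Ring ring
    using (-0#≈0#; -‿involutive; -‿+-comm; -1*x≈-x)
  open import Algebra.Properties.Semiring.Mult.TCOptimised semiring
    using (×-homo-+; ×1-homo-*) renaming (_×_ to _⨯_)
  open import Relation.Binary.Reasoning.Setoid setoid

  -- the image of a natural number; 0 and 1 map to 0# and 1# on the nose
  ⌜_⌝ : ℕ → Carrier
  ⌜ n ⌝ = n ⨯ 1#

  ⌜suc⌝ : ∀ n → ⌜ suc n ⌝ ≈ 1# + ⌜ n ⌝
  ⌜suc⌝ n = ×-homo-+ 1# 1 n

  ⟦_⟧ℤ : ℤ → Carrier
  ⟦ + n ⟧ℤ = ⌜ n ⌝
  ⟦ -[1+ n ] ⟧ℤ = - ⌜ suc n ⌝

  cancel-1+ : ∀ a b → (1# + a) - (1# + b) ≈ a - b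
  cancel-1+ a b = begin
    (1# + a) + - (1# + b)    ≈⟨ +-congˡ (sym (-‿+-comm 1# b)) ⟩
    (1# + a) + (- 1# + - b)  ≈⟨ +-assoc 1# a _ ⟩
    1# + (a + (- 1# + - b))  ≈⟨ +-congˡ (trans (sym (+-assoc a _ _)) (trans (+-congʳ (+-comm a _)) (+-assoc _ a _))) ⟩
    1# + (- 1# + (a + - b))  ≈⟨ sym (+-assoc 1# _ _) ⟩
    (1# + - 1#) + (a + - b)  ≈⟨ +-congʳ (-‿inverseʳ 1#) ⟩
    0# + (a - b)             ≈⟨ +-identityˡ _ ⟩
    a - b                    ∎

  ⊖-homo : ∀ m n → ⟦ m ⊖ n ⟧ℤ ≈ ⌜ m ⌝ - ⌜ n ⌝
  ⊖-homo zero zero = sym (-‿inverseʳ 0#)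
  ⊖-homo zero (suc n) = sym (+-identityˡ _)
  ⊖-homo (suc m) zero = sym (trans (+-congˡ -0#≈0#) (+-identityʳ _))
  ⊖-homo (suc m) (suc n) rewrite ℤ.[1+m]⊖[1+n]≡m⊖n m n = begin
    ⟦ m ⊖ n ⟧ℤ                   ≈⟨ ⊖-homo m n ⟩
    ⌜ m ⌝ - ⌜ n ⌝                ≈⟨ sym (cancel-1+ _ _) ⟩
    (1# + ⌜ m ⌝) - (1# + ⌜ n ⌝)  ≈⟨ sym unfold-suc ⟩
    ⌜ suc m ⌝ - ⌜ suc n ⌝        ∎
    where
    unfold-suc : ⌜ suc m ⌝ - ⌜ suc n ⌝ ≈ (1# + ⌜ m ⌝) - (1# + ⌜ n ⌝)
    unfold-suc = +-cong (⌜suc⌝ m) (-‿cong (⌜suc⌝ n))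

  -‿homo : ∀ i → ⟦ ℤ.- i ⟧ℤ ≈ - ⟦ i ⟧ℤ
  -‿homo (+ zero) = sym -0#≈0#
  -‿homo (+ suc n) = refl
  -‿homo -[1+ n ] = sym (-‿involutive _)

  +-homo : ∀ i j → ⟦ i ℤ.+ j ⟧ℤ ≈ ⟦ i ⟧ℤ + ⟦ j ⟧ℤ
  +-homo -[1+ m ] -[1+ n ] = begin
    - ⌜ suc (suc (m ℕ.+ n)) ⌝         ≡⟨ ≡.cong (λ k → - ⌜ suc k ⌝) (≡.sym (ℕ.+-suc m n)) ⟩
    - ⌜ suc m ℕ.+ suc n ⌝             ≈⟨ -‿cong (×-homo-+ 1# (suc m) (suc n)) ⟩
    - (⌜ suc m ⌝ + ⌜ suc n ⌝)         ≈⟨ sym (-‿+-comm _ _) ⟩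
    - ⌜ suc m ⌝ + - ⌜ suc n ⌝         ∎
  +-homo -[1+ m ] (+ n) = trans (⊖-homo n (suc m)) (+-comm _ _)
  +-homo (+ m) -[1+ n ] = ⊖-homo m (suc n)
  +-homo (+ m) (+ n) = ×-homo-+ 1# m n

  ⟦_⟧± : Sign → Carrier
  ⟦ Sign.+ ⟧± = 1#
  ⟦ Sign.- ⟧± = - 1#

  ◃-homo : ∀ s n → ⟦ s ◃ n ⟧ℤ ≈ ⟦ s ⟧± * ⌜ n ⌝
  ◃-homo s zero = sym (zeroʳ _)
  ◃-homo Sign.+ (suc n) = sym (*-identityˡ _)
  ◃-homo Sign.- (suc n) = sym (-1*x≈-x _)

  sign-homo : ∀ s t → ⟦ s Sign.* t ⟧± ≈ ⟦ s ⟧± * ⟦ t ⟧±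
  sign-homo Sign.- Sign.- = sym (trans (-1*x≈-x _) (-‿involutive 1#))
  sign-homo Sign.- Sign.+ = sym (*-identityʳ _)
  sign-homo Sign.+ t = sym (*-identityˡ _)

  *-homo : ∀ i j → ⟦ i ℤ.* j ⟧ℤ ≈ ⟦ i ⟧ℤ * ⟦ j ⟧ℤ
  *-homo i j = begin
    ⟦ (sign i Sign.* sign j) ◃ (∣ i ∣ ℕ.* ∣ j ∣) ⟧ℤ  ≈⟨ ◃-homo (sign i Sign.* sign j) (∣ i ∣ ℕ.* ∣ j ∣) ⟩
    ⟦ sign i Sign.* sign j ⟧± * ⌜ ∣ i ∣ ℕ.* ∣ j ∣ ⌝  ≈⟨ *-cong (sign-homo (sign i) (sign j)) (×1-homo-* ∣ i ∣ ∣ j ∣) ⟩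
    (⟦ sign i ⟧± * ⟦ sign j ⟧±) * (⌜ ∣ i ∣ ⌝ * ⌜ ∣ j ∣ ⌝)  ≈⟨ interchange _ _ _ _ ⟩
    (⟦ sign i ⟧± * ⌜ ∣ i ∣ ⌝) * (⟦ sign j ⟧± * ⌜ ∣ j ∣ ⌝)  ≈⟨ sym (*-cong (signAbs i) (signAbs j)) ⟩
    ⟦ i ⟧ℤ * ⟦ j ⟧ℤ                                  ∎
    where
    signAbs : ∀ k → ⟦ k ⟧ℤ ≈ ⟦ sign k ⟧± * ⌜ ∣ k ∣ ⌝
    signAbs k = trans (reflexive (≡.cong ⟦_⟧ℤ (≡.sym (ℤ.◃-inverse k)))) (◃-homo (sign k) ∣ k ∣)
    interchange : ∀ a b x y → (a * b) * (x * y) ≈ (a * x) * (b * y)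
    interchange a b x y = begin
      (a * b) * (x * y)  ≈⟨ *-assoc a b _ ⟩
      a * (b * (x * y))  ≈⟨ *-congˡ (trans (sym (*-assoc b x y)) (trans (*-congʳ (*-comm b x)) (*-assoc x b y))) ⟩
      a * (x * (b * y))  ≈⟨ sym (*-assoc a x _) ⟩
      (a * x) * (b * y)  ∎

  ℤ⟶R : ℤ.+-*-rawRing -Raw-AlmostCommutative⟶ fromCommutativeRing R
  ℤ⟶R = record
    { ⟦_⟧ = ⟦_⟧ℤ ; +-homo = +-homo ; *-homo = *-homo ; -‿homo = -‿homo
    ; 0-homo = refl ; 1-homo = refl }

  coefficient≟ : ∀ i j → Maybe (⟦ i ⟧ℤ ≈ ⟦ j ⟧ℤ)
  coefficient≟ i j with i ℤ.≟ j
  ... | yes ≡.refl = just refl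
  ... | no _ = nothing

  open import Algebra.Solver.Ring ℤ.+-*-rawRing (fromCommutativeRing R) ℤ⟶R coefficient≟ public

  𝟘 𝟙 : ∀ {n} → Polynomial n
  𝟘 = con (+ 0)
  𝟙 = con (+ 1)

module Matrices {c ℓ} (K : Field c ℓ) (θ : Hecke.Character K) where
  open Field K
  open Hecke K using (Mat; mat)
  private module H = Hecke K
  open IntegerSolver commutativeRing
    using (Polynomial; 𝟘; 𝟙; var; _:+_; _:*_; :-_; ⟦_⟧; ⟦_⟧↓; prove)

  infix  4 _≈M_
  infixl 6 _+M_
  infixl 7 _·M_
  _≈M_ : Mat θ → Mat θ → Set ℓ
  _≈M_ = H._≈M_ θ
  _+M_ _·M_ : Mat θ → Mat θ → Mat θ
  _+M_ = H._+M_ θ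
  _·M_ = H._·M_ θ
  scalarM : Carrier → Mat θ
  scalarM = H.scalarM θ

  scaleM : Carrier → Mat θ → Mat θ
  scaleM k (mat a b c' d) = mat (k * a) (k * b) (k * c') (k * d)

  ≈M-refl : ∀ {A} → A ≈M A
  ≈M-refl = refl , refl , refl , refl

  ≈M-sym : ∀ {A B} → A ≈M B → B ≈M A
  ≈M-sym (p , q , r , s) = sym p , sym q , sym r , sym s

  ≈M-trans : ∀ {A B C} → A ≈M B → B ≈M C → A ≈M C
  ≈M-trans (p , q , r , s) (p' , q' , r' , s') = trans p p' , trans q q' , trans r r' , trans s s'

  +M-cong : ∀ {A A' B B'} → A ≈M A' → B ≈M B' → A +M B ≈M A' +M B'
  +M-cong (p , q , r , s) (p' , q' , r' , s') = +-cong p p' , +-cong q q' , +-cong r r' , +-cong s s'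

  ·M-cong : ∀ {A A' B B'} → A ≈M A' → B ≈M B' → A ·M B ≈M A' ·M B'
  ·M-cong (p , q , r , s) (p' , q' , r' , s') =
    +-cong (*-cong p p') (*-cong q r') , +-cong (*-cong p q') (*-cong q s') ,
    +-cong (*-cong r p') (*-cong s r') , +-cong (*-cong r q') (*-cong s s')

  scalarM-cong : ∀ {a b} → a ≈ b → scalarM a ≈M scalarM b
  scalarM-cong p = p , refl , refl , p

  scaleM-cong : ∀ {k A B} → A ≈M B → scaleM k A ≈M scaleM k B
  scaleM-cong (p , q , r , s) = *-congˡ p , *-congˡ q , *-congˡ r , *-congˡ s

  -- Matrices of polynomials, so that matrix identities can be proved by
  -- normalising the four entries with the ring solver.
  record PMat (n : ℕ) : Set c where
    constructor pmat
    field p₁₁ p₁₂ p₂₁ p₂₂ : Polynomial n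

  infixl 6 _+ₚ_
  infixl 7 _·ₚ_
  infix  4 _⊜_
  _+ₚ_ _·ₚ_ : ∀ {n} → PMat n → PMat n → PMat n
  pmat a b c' d +ₚ pmat a' b' c'' d' = pmat (a :+ a') (b :+ b') (c' :+ c'') (d :+ d')
  pmat a b c' d ·ₚ pmat a' b' c'' d' =
    pmat (a :* a' :+ b :* c'') (a :* b' :+ b :* d') (c' :* a' :+ d :* c'') (c' :* b' :+ d :* d')

  _⊜_ : ∀ {n} → PMat n → PMat n → PMat n × PMat n
  _⊜_ = _,_

  scalarₚ : ∀ {n} → Polynomial n → PMat n
  scalarₚ x = pmat x 𝟘 𝟘 x

  scaleₚ : ∀ {n} → Polynomial n → PMat n → PMat n
  scaleₚ k (pmat a b c' d) = pmat (k :* a) (k :* b) (k :* c') (k :* d)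

  ⟦_⟧ₘ ⟦_⟧↓ₘ : ∀ {n} → PMat n → Vec Carrier n → Mat θ
  ⟦ pmat a b c' d ⟧ₘ ρ = mat (⟦ a ⟧ ρ) (⟦ b ⟧ ρ) (⟦ c' ⟧ ρ) (⟦ d ⟧ ρ)
  ⟦ pmat a b c' d ⟧↓ₘ ρ = mat (⟦ a ⟧↓ ρ) (⟦ b ⟧↓ ρ) (⟦ c' ⟧↓ ρ) (⟦ d ⟧↓ ρ)

  proveₘ : ∀ {n} (ρ : Vec Carrier n) P Q → ⟦ P ⟧↓ₘ ρ ≈M ⟦ Q ⟧↓ₘ ρ → ⟦ P ⟧ₘ ρ ≈M ⟦ Q ⟧ₘ ρ
  proveₘ ρ (pmat a b c' d) (pmat a' b' c'' d') (p , q , r , s) =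
    prove ρ a a' p , prove ρ b b' q , prove ρ c' c'' r , prove ρ d d' s

  -- the matrix analogue of the standard library's `solve`
  solveₘ : ∀ n (f : N-ary n (Polynomial n) (PMat n × PMat n)) →
    let P = proj₁ (f $ⁿ Vec.map var (allFin n))
        Q = proj₂ (f $ⁿ Vec.map var (allFin n))
    in Eqʰ n _≈M_ (curryⁿ ⟦ P ⟧↓ₘ) (curryⁿ ⟦ Q ⟧↓ₘ) → Eq n _≈M_ (curryⁿ ⟦ P ⟧ₘ) (curryⁿ ⟦ Q ⟧ₘ)
  solveₘ n f hyp = curryⁿ-cong _≈M_ ⟦ P ⟧ₘ ⟦ Q ⟧ₘ λ ρ →
    proveₘ ρ P Q (curryⁿ-cong⁻¹ _≈M_ ⟦ P ⟧↓ₘ ⟦ Q ⟧↓ₘ (Eqʰ-to-Eq n _≈M_ hyp) ρ)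
    where
    P = proj₁ (f $ⁿ Vec.map var (allFin n))
    Q = proj₂ (f $ⁿ Vec.map var (allFin n))

  ·M-assoc : ∀ A B C → (A ·M B) ·M C ≈M A ·M (B ·M C)
  ·M-assoc (mat a b c' d) (mat e f g h) (mat i j k l) =
    solveₘ 12 (λ a b c' d e f g h i j k l →
      let A = pmat a b c' d; B = pmat e f g h; C = pmat i j k l in (A ·ₚ B) ·ₚ C ⊜ A ·ₚ (B ·ₚ C))
      ≈M-refl a b c' d e f g h i j k l

  +M-assoc : ∀ A B C → (A +M B) +M C ≈M A +M (B +M C)
  +M-assoc (mat a b c' d) (mat e f g h) (mat i j k l) =
    solveₘ 12 (λ a b c' d e f g h i j k l →
      let A = pmat a b c' d; B = pmat e f g h; C = pmat i j k l in (A +ₚ B) +ₚ C ⊜ A +ₚ (B +ₚ C))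
      ≈M-refl a b c' d e f g h i j k l

  +M-comm : ∀ A B → A +M B ≈M B +M A
  +M-comm (mat a b c' d) (mat e f g h) =
    solveₘ 8 (λ a b c' d e f g h → let A = pmat a b c' d; B = pmat e f g h in A +ₚ B ⊜ B +ₚ A)
      ≈M-refl a b c' d e f g h

  +M-identityˡ : ∀ A → scalarM 0# +M A ≈M A
  +M-identityˡ (mat a b c' d) =
    solveₘ 4 (λ a b c' d → scalarₚ 𝟘 +ₚ pmat a b c' d ⊜ pmat a b c' d) ≈M-refl a b c' d

  +M-inverseˡ : ∀ A → scalarM (- 1#) ·M A +M A ≈M scalarM 0#
  +M-inverseˡ (mat a b c' d) =
    solveₘ 4 (λ a b c' d → let A = pmat a b c' d in scalarₚ (:- 𝟙) ·ₚ A +ₚ A ⊜ scalarₚ 𝟘)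
      ≈M-refl a b c' d

  ·M-identityˡ : ∀ A → scalarM 1# ·M A ≈M A
  ·M-identityˡ (mat a b c' d) =
    solveₘ 4 (λ a b c' d → scalarₚ 𝟙 ·ₚ pmat a b c' d ⊜ pmat a b c' d) ≈M-refl a b c' d

  ·M-identityʳ : ∀ A → A ·M scalarM 1# ≈M A
  ·M-identityʳ (mat a b c' d) =
    solveₘ 4 (λ a b c' d → pmat a b c' d ·ₚ scalarₚ 𝟙 ⊜ pmat a b c' d) ≈M-refl a b c' d

  ·M-distribˡ : ∀ A B C → A ·M (B +M C) ≈M A ·M B +M A ·M C
  ·M-distribˡ (mat a b c' d) (mat e f g h) (mat i j k l) =
    solveₘ 12 (λ a b c' d e f g h i j k l →
      let A = pmat a b c' d; B = pmat e f g h; C = pmat i j k l in A ·ₚ (B +ₚ C) ⊜ A ·ₚ B +ₚ A ·ₚ C)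
      ≈M-refl a b c' d e f g h i j k l

  ·M-distribʳ : ∀ A B C → (B +M C) ·M A ≈M B ·M A +M C ·M A
  ·M-distribʳ (mat a b c' d) (mat e f g h) (mat i j k l) =
    solveₘ 12 (λ a b c' d e f g h i j k l →
      let A = pmat a b c' d; B = pmat e f g h; C = pmat i j k l in (B +ₚ C) ·ₚ A ⊜ B ·ₚ A +ₚ C ·ₚ A)
      ≈M-refl a b c' d e f g h i j k l

  scalarM-+ : ∀ a b → scalarM (a + b) ≈M scalarM a +M scalarM b
  scalarM-+ a b = solveₘ 2 (λ a b → scalarₚ (a :+ b) ⊜ scalarₚ a +ₚ scalarₚ b) ≈M-refl a b

  scalarM-* : ∀ a b → scalarM (a * b) ≈M scalarM a ·M scalarM b
  scalarM-* a b = solveₘ 2 (λ a b → scalarₚ (a :* b) ⊜ scalarₚ a ·ₚ scalarₚ b) ≈M-refl a b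

  scalarM-central : ∀ k A → scalarM k ·M A ≈M A ·M scalarM k
  scalarM-central k (mat a b c' d) =
    solveₘ 5 (λ k a b c' d → let A = pmat a b c' d in scalarₚ k ·ₚ A ⊜ A ·ₚ scalarₚ k)
      ≈M-refl k a b c' d

  ·M-scaleʳ : ∀ k A B → A ·M scaleM k B ≈M scaleM k (A ·M B)
  ·M-scaleʳ k (mat a b c' d) (mat e f g h) =
    solveₘ 9 (λ k a b c' d e f g h → let A = pmat a b c' d; B = pmat e f g h in
      A ·ₚ scaleₚ k B ⊜ scaleₚ k (A ·ₚ B)) ≈M-refl k a b c' d e f g h

  ·M-scaleˡ : ∀ k A B → scaleM k A ·M B ≈M scaleM k (A ·M B)
  ·M-scaleˡ k (mat a b c' d) (mat e f g h) =
    solveₘ 9 (λ k a b c' d e f g h → let A = pmat a b c' d; B = pmat e f g h in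
      scaleₚ k A ·ₚ B ⊜ scaleₚ k (A ·ₚ B)) ≈M-refl k a b c' d e f g h

  scaleM-scalarM : ∀ k x → scaleM k (scalarM x) ≈M scalarM (k * x)
  scaleM-scalarM k x = solveₘ 2 (λ k x → scaleₚ k (scalarₚ x) ⊜ scalarₚ (k :* x)) ≈M-refl k x

-- Representations of ℋ_θ on K_θ, among them 𝒜_θ itself.
module Representations {c ℓ} (K : Field c ℓ) (θ : Hecke.Character K) where
  open Field K
  open Hecke K hiding (_≈M_; _+M_; _·M_; scalarM)
  open Character θ
  open Matrices K θ
  open IntegerSolver commutativeRing using (solve; _:=_; _:+_; _:*_; :-_; 𝟘; 𝟙)

  Mat-setoid : Setoid c ℓ
  Mat-setoid = record { Carrier = Mat θ ; _≈_ = _≈M_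
    ; isEquivalence = record { refl = ≈M-refl ; sym = ≈M-sym ; trans = ≈M-trans } }

  t₂⁻¹t₂≈1 : t₂⁻¹ * t₂ ≈ 1#
  t₂⁻¹t₂≈1 = trans (*-comm t₂⁻¹ t₂) t₂-inv

  record Relations (s u v : Mat θ) : Set ℓ where
    field
      uv≈1    : u ·M v ≈M scalarM 1#
      vu≈1    : v ·M u ≈M scalarM 1#
      ss≈-s   : s ·M s ≈M scalarM (- 1#) ·M s
      uus≈suu : u ·M u ·M s ≈M s ·M (u ·M u)
      ζ₁↦t₁   : u ·M s +M u +M s ·M u ≈M scalarM t₁
      ζ₂↦t₂   : u ·M u ≈M scalarM t₂

  induced : (s u v : Mat θ) → Tm → Mat θ
  induced s u v gS = s
  induced s u v gU = u
  induced s u v gU⁻¹ = v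
  induced s u v (sc x) = scalarM x
  induced s u v (x ⊕ y) = induced s u v x +M induced s u v y
  induced s u v (x ⊗ y) = induced s u v x ·M induced s u v y

  induced-respects : ∀ {s u v} → Relations s u v → ∀ {x y} → _~_ θ x y →
                     induced s u v x ≈M induced s u v y
  induced-respects {s} {u} {v} rel = go
    where
    open Relations rel
    I = induced s u v
    go : ∀ {x y} → _~_ θ x y → I x ≈M I y
    go ~refl = ≈M-refl
    go (~sym p) = ≈M-sym (go p)
    go (~trans p q) = ≈M-trans (go p) (go q)
    go (⊕-cong p q) = +M-cong (go p) (go q)
    go (⊗-cong p q) = ·M-cong (go p) (go q)
    go (sc-cong p) = scalarM-cong p
    go (⊕-assoc x y z) = +M-assoc (I x) (I y) (I z)
    go (⊕-comm x y) = +M-comm (I x) (I y)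
    go (⊕-idˡ x) = +M-identityˡ (I x)
    go (⊕-invˡ x) = +M-inverseˡ (I x)
    go (⊗-assoc x y z) = ·M-assoc (I x) (I y) (I z)
    go (⊗-idˡ x) = ·M-identityˡ (I x)
    go (⊗-idʳ x) = ·M-identityʳ (I x)
    go (~distribˡ x y z) = ·M-distribˡ (I x) (I y) (I z)
    go (~distribʳ x y z) = ·M-distribʳ (I x) (I y) (I z)
    go (sc-+ a b) = scalarM-+ a b
    go (sc-* a b) = scalarM-* a b
    go (sc-central a x) = scalarM-central a (I x)
    go UU⁻¹ = uv≈1
    go U⁻¹U = vu≈1
    go SS = ss≈-s
    go UUS = uus≈suu
    go θζ₁ = ζ₁↦t₁
    go θζ₂ = ζ₂↦t₂

  traceless : Carrier → Carrier → Mat θ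
  traceless b c' = mat t₁ b c' (- t₁)

  traceless² : ∀ b c' → traceless b c' ·M traceless b c' ≈M scalarM (t₁ * t₁ + b * c')
  traceless² b c' = solveₘ 3 (λ t b c' → let u = pmat t b c' (:- t) in
    u ·ₚ u ⊜ scalarₚ (t :* t :+ b :* c')) ≈M-refl t₁ b c'

  traceless-ζ₁ : ∀ b c' → let u = traceless b c' in
                 u ·M AS θ +M u +M AS θ ·M u ≈M scalarM t₁
  traceless-ζ₁ b c' = solveₘ 3 (λ t b c' → let u = pmat t b c' (:- t); s = pmat 𝟘 𝟘 𝟘 (:- 𝟙) in
    u ·ₚ s +ₚ u +ₚ s ·ₚ u ⊜ scalarₚ t) ≈M-refl t₁ b c'

  AS² : AS θ ·M AS θ ≈M scalarM (- 1#) ·M AS θ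
  AS² = solveₘ 0 (let s = pmat 𝟘 𝟘 𝟘 (:- 𝟙) in s ·ₚ s ⊜ scalarₚ (:- 𝟙) ·ₚ s) ≈M-refl

  traceless-relations : ∀ b c' v → t₁ * t₁ + b * c' ≈ t₂ → v ≈M scaleM t₂⁻¹ (traceless b c') →
                        Relations (AS θ) (traceless b c') v
  traceless-relations b c' v det v≈ = record
    { uv≈1 = begin
        u ·M v                       ≈⟨ ·M-cong ≈M-refl v≈ ⟩
        u ·M scaleM t₂⁻¹ u           ≈⟨ ·M-scaleʳ t₂⁻¹ u u ⟩
        scaleM t₂⁻¹ (u ·M u)         ≈⟨ inverse-scaled ⟩
        scalarM 1#                   ∎
    ; vu≈1 = begin
        v ·M u                       ≈⟨ ·M-cong v≈ ≈M-refl ⟩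
        scaleM t₂⁻¹ u ·M u           ≈⟨ ·M-scaleˡ t₂⁻¹ u u ⟩
        scaleM t₂⁻¹ (u ·M u)         ≈⟨ inverse-scaled ⟩
        scalarM 1#                   ∎
    ; ss≈-s = AS²
    ; uus≈suu = begin
        u ·M u ·M s                  ≈⟨ ·M-cong u²≈t₂ ≈M-refl ⟩
        scalarM t₂ ·M s              ≈⟨ scalarM-central t₂ s ⟩
        s ·M scalarM t₂              ≈⟨ ·M-cong ≈M-refl (≈M-sym u²≈t₂) ⟩
        s ·M (u ·M u)                ∎
    ; ζ₁↦t₁ = traceless-ζ₁ b c'
    ; ζ₂↦t₂ = u²≈t₂
    }
    where
    open SetoidReasoning Mat-setoid
    u = traceless b c'
    s = AS θ
    u²≈t₂ : u ·M u ≈M scalarM t₂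
    u²≈t₂ = ≈M-trans (traceless² b c') (scalarM-cong det)
    inverse-scaled : scaleM t₂⁻¹ (u ·M u) ≈M scalarM 1#
    inverse-scaled = ≈M-trans (scaleM-cong u²≈t₂)
                       (≈M-trans (scaleM-scalarM t₂⁻¹ t₂) (scalarM-cong t₂⁻¹t₂≈1))

  -- the (1,2) entry of 𝒜(U), so that 𝒜(U) ≡ traceless b𝒜 (- t₂)
  b𝒜 : Carrier
  b𝒜 = t₂⁻¹ * (t₁ * t₁) + - 1#

  -- b𝒜 = -t₂⁻¹(t₂ - t₁²) vanishes exactly when t₁² = t₂
  t₁²≈t₂⇒b𝒜≈0 : t₁ * t₁ ≈ t₂ → b𝒜 ≈ 0#
  t₁²≈t₂⇒b𝒜≈0 h = begin
    t₂⁻¹ * (t₁ * t₁) + - 1#   ≈⟨ +-congʳ (trans (*-congˡ h) t₂⁻¹t₂≈1) ⟩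
    1# + - 1#                 ≈⟨ -‿inverseʳ 1# ⟩
    0#                        ∎
    where open SetoidReasoning setoid

  b𝒜≈0⇒t₁²≈t₂ : b𝒜 ≈ 0# → t₁ * t₁ ≈ t₂
  b𝒜≈0⇒t₁²≈t₂ h = begin
    t₁ * t₁                          ≈⟨ sym (trans (*-congʳ t₂-inv) (*-identityˡ _)) ⟩
    (t₂ * t₂⁻¹) * (t₁ * t₁)          ≈⟨ solve 3 (λ t a i → (a :* i) :* (t :* t) := a :* ((i :* (t :* t) :+ :- 𝟙) :+ 𝟙)) refl t₁ t₂ t₂⁻¹ ⟩
    t₂ * (b𝒜 + 1#)                   ≈⟨ *-congˡ (trans (+-congʳ h) (+-identityˡ 1#)) ⟩
    t₂ * 1#                          ≈⟨ *-identityʳ t₂ ⟩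
    t₂                               ∎
    where open SetoidReasoning setoid

  𝒜-relations : Relations (AS θ) (AU θ) (AU⁻¹ θ)
  𝒜-relations = traceless-relations b𝒜 (- t₂) (AU⁻¹ θ) det
    (refl , refl , sym (trans (sym (-‿distribʳ-* t₂⁻¹ t₂)) (-‿cong t₂⁻¹t₂≈1)) , -‿distribʳ-* t₂⁻¹ t₁)
    where
    open import Algebra.Properties.Ring ring using (-‿distribʳ-*)
    det : t₁ * t₁ + b𝒜 * (- t₂) ≈ t₂
    det = begin
      t₁ * t₁ + b𝒜 * (- t₂)                      ≈⟨ solve 3 (λ t a i → t :* t :+ (i :* (t :* t) :+ :- 𝟙) :* (:- a) := t :* t :+ a :+ (:- ((a :* i) :* (t :* t)))) refl t₁ t₂ t₂⁻¹ ⟩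
      t₁ * t₁ + t₂ + - ((t₂ * t₂⁻¹) * (t₁ * t₁))  ≈⟨ +-congˡ (-‿cong (trans (*-congʳ t₂-inv) (*-identityˡ _))) ⟩
      t₁ * t₁ + t₂ + - (t₁ * t₁)                  ≈⟨ solve 2 (λ t a → t :* t :+ a :+ (:- (t :* t)) := a) refl t₁ t₂ ⟩
      t₂                                          ∎
      where open SetoidReasoning setoid

  𝒜≈induced : ∀ x → 𝒜 θ x ≈M induced (AS θ) (AU θ) (AU⁻¹ θ) x
  𝒜≈induced gS = ≈M-refl
  𝒜≈induced gU = ≈M-refl
  𝒜≈induced gU⁻¹ = ≈M-refl
  𝒜≈induced (sc x) = ≈M-refl
  𝒜≈induced (x ⊕ y) = +M-cong (𝒜≈induced x) (𝒜≈induced y)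
  𝒜≈induced (x ⊗ y) = ·M-cong (𝒜≈induced x) (𝒜≈induced y)

  𝒜-respects : ∀ x y → _~_ θ x y → 𝒜 θ x ≈M 𝒜 θ y
  𝒜-respects x y p = ≈M-trans (𝒜≈induced x)
    (≈M-trans (induced-respects 𝒜-relations p) (≈M-sym (𝒜≈induced y)))

  -- (1 + S) U S: it acts through the (1,2) entry of the image of U
  corner : Tm
  corner = (sc 1# ⊕ gS) ⊗ gU ⊗ gS

  corner↦ : ∀ b c' → (scalarM 1# +M AS θ) ·M traceless b c' ·M AS θ ≈M mat 0# (- b) 0# 0#
  corner↦ b c' = solveₘ 3 (λ t b c' → let u = pmat t b c' (:- t); s = pmat 𝟘 𝟘 𝟘 (:- 𝟙) in
    (scalarₚ 𝟙 +ₚ s) ·ₚ u ·ₚ s ⊜ pmat 𝟘 (:- b) 𝟘 𝟘) ≈M-refl t₁ b c'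

  -- If t₁² = t₂, then 𝒜_θ kills (1 + S) U S, but the representation with
  -- U ↦ traceless 1 0 does not, so that element is nonzero in ℋ_θ.
  not-faithful : t₁ * t₁ ≈ t₂ → ¬ Faithful θ
  not-faithful h faithful = 1≉0 (begin
    1#        ≈⟨ sym (-‿involutive 1#) ⟩
    - - 1#    ≈⟨ -‿cong -1≈0 ⟩
    - 0#      ≈⟨ -0#≈0# ⟩
    0#        ∎)
    where
    open SetoidReasoning setoid
    open import Algebra.Properties.Ring ring using (-‿involutive; -0#≈0#)
    degenerate : Relations (AS θ) (traceless 1# 0#) (scaleM t₂⁻¹ (traceless 1# 0#))
    degenerate = traceless-relations 1# 0# _ (trans (+-congˡ (zeroʳ 1#)) (trans (+-identityʳ _) h)) ≈M-refl
    𝒜corner≈0 : 𝒜 θ corner ≈M 𝒜 θ (sc 0#)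
    𝒜corner≈0 = ≈M-trans (corner↦ b𝒜 (- t₂))
      (refl , trans (-‿cong (t₁²≈t₂⇒b𝒜≈0 h)) -0#≈0# , refl , refl)
    -1≈0 : - 1# ≈ 0#
    -1≈0 = proj₁ (proj₂ (≈M-trans (≈M-sym (corner↦ 1# 0#))
             (induced-respects degenerate (faithful corner (sc 0#) 𝒜corner≈0))))

-- Computations inside ℋ_θ itself (on representatives, up to _~_).
module HeckeCalculus {c ℓ} (K : Field c ℓ) (θ : Hecke.Character K) where
  open Field K
  open Hecke K hiding (_≈M_; _+M_; _·M_; scalarM)
  open Character θ
  open IntegerSolver commutativeRing using (solve; _:=_; _:+_; _:*_; :-_; 𝟙)

  infix 4 _≃_
  _≃_ : Tm → Tm → Set (c ⊔ ℓ)
  _≃_ = _~_ θ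

  ℋθ-setoid : Setoid c (c ⊔ ℓ)
  ℋθ-setoid = record { Carrier = Tm ; _≈_ = _≃_
    ; isEquivalence = record { refl = ~refl ; sym = ~sym ; trans = ~trans } }
  open SetoidReasoning ℋθ-setoid

  neg : Tm → Tm
  neg x = sc (- 1#) ⊗ x

  ⊕-idʳ : ∀ x → x ⊕ sc 0# ≃ x
  ⊕-idʳ x = ~trans (⊕-comm _ _) (⊕-idˡ x)

  ⊕-invʳ : ∀ x → x ⊕ neg x ≃ sc 0#
  ⊕-invʳ x = ~trans (⊕-comm _ _) (⊕-invˡ x)

  sc-⊗-sc : ∀ a b x → sc a ⊗ (sc b ⊗ x) ≃ sc (a * b) ⊗ x
  sc-⊗-sc a b x = ~trans (~sym (⊗-assoc _ _ _)) (⊗-cong (~sym (sc-* a b)) ~refl)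

  sc-⊕-sc : ∀ a b x → sc a ⊗ x ⊕ sc b ⊗ x ≃ sc (a + b) ⊗ x
  sc-⊕-sc a b x = ~trans (~sym (~distribʳ x (sc a) (sc b))) (⊗-cong (~sym (sc-+ a b)) ~refl)

  sc-congˡ : ∀ {a b} x → a ≈ b → sc a ⊗ x ≃ sc b ⊗ x
  sc-congˡ x p = ⊗-cong (sc-cong p) ~refl

  sc-pull : ∀ a x y → x ⊗ (sc a ⊗ y) ≃ sc a ⊗ (x ⊗ y)
  sc-pull a x y = ~trans (~sym (⊗-assoc _ _ _)) (~trans (⊗-cong (~sym (sc-central a x)) ~refl) (⊗-assoc _ _ _))

  zero-⊗ : ∀ x → sc 0# ⊗ x ≃ sc 0#
  zero-⊗ x = ~sym (begin
    sc 0#             ≈⟨ ~sym (⊕-invˡ z) ⟩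
    neg z ⊕ z         ≈⟨ ⊕-cong ~refl z≃z⊕z ⟩
    neg z ⊕ (z ⊕ z)   ≈⟨ ~sym (⊕-assoc _ _ _) ⟩
    (neg z ⊕ z) ⊕ z   ≈⟨ ⊕-cong (⊕-invˡ z) ~refl ⟩
    sc 0# ⊕ z         ≈⟨ ⊕-idˡ z ⟩
    z                 ∎)
    where
    z = sc 0# ⊗ x
    z≃z⊕z : z ≃ z ⊕ z
    z≃z⊕z = ~trans (sc-congˡ x (sym (+-identityˡ 0#))) (~sym (sc-⊕-sc 0# 0# x))

  ⊗-zero : ∀ x → x ⊗ sc 0# ≃ sc 0#
  ⊗-zero x = ~trans (~sym (sc-central _ x)) (zero-⊗ x)

  infix 4 _≐_⊙_
  _≐_⊙_ : Tm → Carrier → Tm → Set (c ⊔ ℓ)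
  X ≐ a ⊙ Y = X ≃ sc a ⊗ Y

  infixr 5 _▸_
  _▸_ : ∀ {X Y Z a b} → X ≐ a ⊙ Y → Y ≐ b ⊙ Z → X ≐ a * b ⊙ Z
  _▸_ {Z = Z} {a} {b} p q = ~trans p (~trans (⊗-cong ~refl q) (sc-⊗-sc a b Z))

  rescale : ∀ {X Y a b} → a ≈ b → X ≐ a ⊙ Y → X ≐ b ⊙ Y
  rescale {Y = Y} e p = ~trans p (sc-congˡ Y e)

  ≃⇒≐1 : ∀ {X Y} → X ≃ Y → X ≐ 1# ⊙ Y
  ≃⇒≐1 p = ~trans p (~sym (⊗-idˡ _))

  ≐1⇒≃ : ∀ {X Y} → X ≐ 1# ⊙ Y → X ≃ Y
  ≐1⇒≃ p = ~trans p (⊗-idˡ _)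

  cancel-scalar : ∀ {X Y k k' m} → k' * k ≈ 1# → sc k ⊗ X ≃ sc m ⊗ Y → X ≐ k' * m ⊙ Y
  cancel-scalar {X} {Y} {k} {k'} {m} inv eq = begin
    X                      ≈⟨ ~sym (⊗-idˡ X) ⟩
    sc 1# ⊗ X              ≈⟨ sc-congˡ X (sym inv) ⟩
    sc (k' * k) ⊗ X        ≈⟨ ~sym (sc-⊗-sc _ _ X) ⟩
    sc k' ⊗ (sc k ⊗ X)     ≈⟨ ⊗-cong ~refl eq ⟩
    sc k' ⊗ (sc m ⊗ Y)     ≈⟨ sc-⊗-sc _ _ Y ⟩
    sc (k' * m) ⊗ Y        ∎

  subtract : ∀ {A B C Z a b} → A ≃ B ⊕ C → A ≐ a ⊙ Z → B ≐ b ⊙ Z → C ≐ a + (- 1#) * b ⊙ Z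
  subtract {A} {B} {C} {Z} {a} {b} split pa pb = begin
    C                                      ≈⟨ ~sym (⊕-idˡ C) ⟩
    sc 0# ⊕ C                              ≈⟨ ⊕-cong (~sym (⊕-invˡ B)) ~refl ⟩
    (neg B ⊕ B) ⊕ C                        ≈⟨ ⊕-assoc _ _ _ ⟩
    neg B ⊕ (B ⊕ C)                        ≈⟨ ⊕-cong ~refl (~sym split) ⟩
    neg B ⊕ A                              ≈⟨ ⊕-comm _ _ ⟩
    A ⊕ neg B                              ≈⟨ ⊕-cong pa (⊗-cong ~refl pb) ⟩
    sc a ⊗ Z ⊕ sc (- 1#) ⊗ (sc b ⊗ Z)      ≈⟨ ⊕-cong ~refl (sc-⊗-sc _ _ Z) ⟩
    sc a ⊗ Z ⊕ sc ((- 1#) * b) ⊗ Z         ≈⟨ sc-⊕-sc _ _ Z ⟩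
    sc (a + (- 1#) * b) ⊗ Z                ∎

  -- Words: right-nested products x₁ ⊗ (x₂ ⊗ … ⊗ 1).  They let us rewrite
  -- a segment in the middle of a product without reassociating by hand.
  ∏ : List Tm → Tm
  ∏ [] = sc 1#
  ∏ (x ∷ xs) = x ⊗ ∏ xs

  ∏-++ : ∀ xs ys → ∏ (xs ++ ys) ≃ ∏ xs ⊗ ∏ ys
  ∏-++ [] ys = ~sym (⊗-idˡ _)
  ∏-++ (x ∷ xs) ys = ~trans (⊗-cong ~refl (∏-++ xs ys)) (~sym (⊗-assoc _ _ _))

  ∏-inside : ∀ xs {seg seg' a} ys → ∏ seg ≐ a ⊙ ∏ seg' →
             ∏ (xs ++ seg ++ ys) ≐ a ⊙ ∏ (xs ++ seg' ++ ys)
  ∏-inside [] {seg} {seg'} {a} ys p = begin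
    ∏ (seg ++ ys)              ≈⟨ ∏-++ seg ys ⟩
    ∏ seg ⊗ ∏ ys               ≈⟨ ⊗-cong p ~refl ⟩
    (sc a ⊗ ∏ seg') ⊗ ∏ ys     ≈⟨ ⊗-assoc _ _ _ ⟩
    sc a ⊗ (∏ seg' ⊗ ∏ ys)     ≈⟨ ⊗-cong ~refl (~sym (∏-++ seg' ys)) ⟩
    sc a ⊗ ∏ (seg' ++ ys)      ∎
  ∏-inside (x ∷ xs) {a = a} ys p = ~trans (⊗-cong ~refl (∏-inside xs ys p)) (sc-pull a x _)

  ∏-inside-zero : ∀ xs {seg} ys → ∏ seg ≃ sc 0# → ∏ (xs ++ seg ++ ys) ≃ sc 0#
  ∏-inside-zero xs {seg} ys p =
    ~trans (∏-inside xs {seg} {[]} ys (~trans p (~sym (zero-⊗ (sc 1#))))) (zero-⊗ _)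

  ∏-cong-at : ∀ xs {x x'} ys → x ≃ x' → ∏ (xs ++ x ∷ ys) ≃ ∏ (xs ++ x' ∷ ys)
  ∏-cong-at [] ys p = ⊗-cong p ~refl
  ∏-cong-at (x ∷ xs) ys p = ⊗-cong ~refl (∏-cong-at xs ys p)

  ∏-distrib-at : ∀ xs {x y} ys → ∏ (xs ++ (x ⊕ y) ∷ ys) ≃ ∏ (xs ++ x ∷ ys) ⊕ ∏ (xs ++ y ∷ ys)
  ∏-distrib-at [] ys = ~distribʳ _ _ _
  ∏-distrib-at (z ∷ xs) ys = ~trans (⊗-cong ~refl (∏-distrib-at xs ys)) (~distribˡ _ _ _)

  ∏-split-at : ∀ xs {x y} ys → ∏ (xs ++ (x ⊗ y) ∷ ys) ≃ ∏ (xs ++ x ∷ y ∷ ys)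
  ∏-split-at xs {x} {y} ys = ≐1⇒≃ (∏-inside xs {(x ⊗ y) ∷ []} {x ∷ y ∷ []} ys (≃⇒≐1 (⊗-assoc _ _ _)))

  ∏-scalar-at : ∀ xs {a} ys → ∏ (xs ++ sc a ∷ ys) ≐ a ⊙ ∏ (xs ++ ys)
  ∏-scalar-at xs {a} ys = ∏-inside xs {sc a ∷ []} {[]} ys ~refl

  ∏-pair : ∀ {x y z a} → x ⊗ y ≐ a ⊙ z → ∏ (x ∷ y ∷ []) ≐ a ⊙ ∏ (z ∷ [])
  ∏-pair p = ~trans (~sym (⊗-assoc _ _ _)) (~trans (⊗-cong p ~refl) (⊗-assoc _ _ _))

  ∏-pair-zero : ∀ {x y} → x ⊗ y ≃ sc 0# → ∏ (x ∷ y ∷ []) ≃ sc 0#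
  ∏-pair-zero p = ~trans (~sym (⊗-assoc _ _ _)) (~trans (⊗-cong p ~refl) (zero-⊗ _))

  -- The complementary idempotents e = 1 + S and f = -S (S² = -S).
  e f : Tm
  e = sc 1# ⊕ gS
  f = neg gS

  Se≃0 : gS ⊗ e ≃ sc 0#
  Se≃0 = ~trans (~distribˡ _ _ _) (~trans (⊕-cong (⊗-idʳ gS) SS) (⊕-invʳ gS))

  eS≃0 : e ⊗ gS ≃ sc 0#
  eS≃0 = ~trans (~distribʳ _ _ _) (~trans (⊕-cong (⊗-idˡ gS) SS) (⊕-invʳ gS))

  Sf≐-f : gS ⊗ f ≐ - 1# ⊙ f
  Sf≐-f = ~trans (sc-pull _ _ _) (⊗-cong ~refl SS)

  fS≐-f : f ⊗ gS ≐ - 1# ⊙ f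
  fS≐-f = ~trans (⊗-assoc _ _ _) (⊗-cong ~refl SS)

  ee≐e : e ⊗ e ≐ 1# ⊙ e
  ee≐e = ~trans (~distribʳ _ _ _) (~trans (⊕-cong (⊗-idˡ e) Se≃0) (~trans (⊕-idʳ e) (~sym (⊗-idˡ e))))

  ef≃0 : e ⊗ f ≃ sc 0#
  ef≃0 = ~trans (~distribʳ _ _ _) (~trans (⊕-cong (⊗-idˡ f) Sf≐-f) (⊕-invʳ f))

  fe≃0 : f ⊗ e ≃ sc 0#
  fe≃0 = ~trans (⊗-assoc _ _ _) (~trans (⊗-cong ~refl Se≃0) (⊗-zero _))

  ff≐f : f ⊗ f ≐ 1# ⊙ f
  ff≐f = ~trans (⊗-assoc _ _ _) (~trans (⊗-cong ~refl Sf≐-f) (~trans (sc-⊗-sc _ _ f)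
           (sc-congˡ f (solve 0 (:- 𝟙 :* :- 𝟙 := 𝟙) refl))))

  e⊕f≃1 : e ⊕ f ≃ sc 1#
  e⊕f≃1 = ~trans (⊕-assoc _ _ _) (~trans (⊕-cong ~refl (⊕-invʳ gS)) (⊕-idʳ _))

  ζ₁-sandwich : ∀ x y → ∏ (x ∷ ζ₁ ∷ y ∷ []) ≃
    (∏ (x ∷ gU ∷ gS ∷ y ∷ []) ⊕ ∏ (x ∷ gU ∷ y ∷ [])) ⊕ ∏ (x ∷ gS ∷ gU ∷ y ∷ [])
  ζ₁-sandwich x y = ~trans (∏-distrib-at (x ∷ []) (y ∷ []))
    (⊕-cong (~trans (∏-distrib-at (x ∷ []) (y ∷ [])) (⊕-cong (∏-split-at (x ∷ []) (y ∷ [])) ~refl))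
            (∏-split-at (x ∷ []) (y ∷ [])))

  ζ₂-sandwich : ∀ x y → ∏ (x ∷ ζ₂ ∷ y ∷ []) ≃ ∏ (x ∷ gU ∷ e ∷ gU ∷ y ∷ []) ⊕ ∏ (x ∷ gU ∷ f ∷ gU ∷ y ∷ [])
  ζ₂-sandwich x y = ~trans (∏-split-at (x ∷ []) (y ∷ []))
    (~trans (~sym (≐1⇒≃ (∏-scalar-at (x ∷ gU ∷ []) (gU ∷ y ∷ []))))
    (~trans (∏-cong-at (x ∷ gU ∷ []) (gU ∷ y ∷ []) (~sym e⊕f≃1)) (∏-distrib-at (x ∷ gU ∷ []) (gU ∷ y ∷ []))))

  -- e U e = t₁ e, read off from e ζ₁ e since S e = e S = 0
  eUe≐t₁e : ∏ (e ∷ gU ∷ e ∷ []) ≐ t₁ ⊙ ∏ (e ∷ [])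
  eUe≐t₁e = rescale (*-identityʳ t₁) (~trans (~sym only-middle) (~trans (∏-cong-at (e ∷ []) (e ∷ []) θζ₁)
              (∏-scalar-at (e ∷ []) (e ∷ []) ▸ ∏-pair ee≐e)))
    where
    only-middle : ∏ (e ∷ ζ₁ ∷ e ∷ []) ≃ ∏ (e ∷ gU ∷ e ∷ [])
    only-middle = ~trans (ζ₁-sandwich e e)
      (~trans (⊕-cong (⊕-cong (∏-inside-zero (e ∷ gU ∷ []) {gS ∷ e ∷ []} [] (∏-pair-zero Se≃0)) ~refl)
                      (∏-inside-zero [] {e ∷ gS ∷ []} (gU ∷ e ∷ []) (∏-pair-zero eS≃0)))
              (~trans (⊕-idʳ _) (⊕-idˡ _)))

  -- f U f = -t₁ f, read off from f ζ₁ f = (-1 + 1 - 1) f U f since S f = f S = -f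
  fUf≐-t₁f : ∏ (f ∷ gU ∷ f ∷ []) ≐ - t₁ ⊙ ∏ (f ∷ [])
  fUf≐-t₁f = rescale (solve 1 (λ t → :- 𝟙 :* (t :* 𝟙) := :- t) refl t₁)
    (cancel-scalar {k = m} (solve 0 (:- 𝟙 :* ((:- 𝟙 :+ 𝟙) :+ :- 𝟙) := 𝟙) refl) m·fUf≐t₁f)
    where
    m = ((- 1#) + 1#) + (- 1#)
    fUf = ∏ (f ∷ gU ∷ f ∷ [])
    fζ₁f≐m·fUf : ∏ (f ∷ ζ₁ ∷ f ∷ []) ≐ m ⊙ fUf
    fζ₁f≐m·fUf = ~trans (ζ₁-sandwich f f)
      (~trans (⊕-cong (⊕-cong (∏-inside (f ∷ gU ∷ []) {gS ∷ f ∷ []} {f ∷ []} [] (∏-pair Sf≐-f))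
                              (~sym (⊗-idˡ fUf)))
                      (∏-inside [] {f ∷ gS ∷ []} {f ∷ []} (gU ∷ f ∷ []) (∏-pair fS≐-f)))
              (~trans (⊕-cong (sc-⊕-sc _ _ fUf) ~refl) (sc-⊕-sc _ _ fUf)))
    m·fUf≐t₁f : sc m ⊗ fUf ≐ t₁ * 1# ⊙ ∏ (f ∷ [])
    m·fUf≐t₁f = ~trans (~sym fζ₁f≐m·fUf)
      (~trans (∏-cong-at (f ∷ []) (f ∷ []) θζ₁) (∏-scalar-at (f ∷ []) (f ∷ []) ▸ ∏-pair ff≐f))

  δ : Carrier
  δ = t₂ + - (t₁ * t₁)

  -- e U f U e = (t₂ - t₁²) e, from e ζ₂ e = e U e U e + e U f U e
  eUfUe≐δe : ∏ (e ∷ gU ∷ f ∷ gU ∷ e ∷ []) ≐ δ ⊙ ∏ (e ∷ [])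
  eUfUe≐δe = rescale (solve 2 (λ t a → a :* 𝟙 :+ :- 𝟙 :* (t :* t) := a :+ (:- (t :* t))) refl t₁ t₂)
    (subtract (ζ₂-sandwich e e)
      (~trans (∏-cong-at (e ∷ []) (e ∷ []) θζ₂) (∏-scalar-at (e ∷ []) (e ∷ []) ▸ ∏-pair ee≐e))
      (∏-inside [] {e ∷ gU ∷ e ∷ []} {e ∷ []} (gU ∷ e ∷ []) eUe≐t₁e ▸ eUe≐t₁e))

  -- f U e U f = (t₂ - t₁²) f, from f ζ₂ f = f U e U f + f U f U f
  fUeUf≐δf : ∏ (f ∷ gU ∷ e ∷ gU ∷ f ∷ []) ≐ δ ⊙ ∏ (f ∷ [])
  fUeUf≐δf = rescale (solve 2 (λ t a → a :* 𝟙 :+ :- 𝟙 :* ((:- t) :* (:- t)) := a :+ (:- (t :* t))) refl t₁ t₂)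
    (subtract (~trans (ζ₂-sandwich f f) (⊕-comm _ _))
      (~trans (∏-cong-at (f ∷ []) (f ∷ []) θζ₂) (∏-scalar-at (f ∷ []) (f ∷ []) ▸ ∏-pair ff≐f))
      (∏-inside [] {f ∷ gU ∷ f ∷ []} {f ∷ []} (gU ∷ f ∷ []) fUf≐-t₁f ▸ fUf≐-t₁f))

-- Inverting 𝒜_θ by matrix units inside ℋ_θ.
module MatrixUnits {c ℓ} (K : Field c ℓ) (θ : Hecke.Character K) where
  open Field K
  open Hecke K hiding (_≈M_; _+M_; _·M_; scalarM)
  open Character θ
  open IntegerSolver commutativeRing using (solve; _:=_; _:+_; _:*_; :-_; 𝟘; 𝟙)
  open Matrices K θ
  open Representations K θ using (b𝒜; t₂⁻¹t₂≈1)
  open HeckeCalculus K θ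

  -- When b𝒜 has an inverse κ, ℋ_θ contains a full system of 2×2 matrix
  -- units E_ij, mapped by 𝒜_θ to the standard matrix units.
  module _ (κ : Carrier) (κ-inv : b𝒜 * κ ≈ 1#) where
    open SetoidReasoning ℋθ-setoid

    w₁₁ w₁₂ w₂₁ w₂₂ : List Tm
    w₁₁ = e ∷ []
    w₁₂ = e ∷ gU ∷ f ∷ []
    w₂₁ = f ∷ gU ∷ e ∷ []
    w₂₂ = f ∷ []

    E₁₁ E₁₂ E₂₁ E₂₂ : Tm
    E₁₁ = sc 1# ⊗ ∏ w₁₁
    E₁₂ = sc κ ⊗ ∏ w₁₂
    E₂₁ = sc (- t₂⁻¹) ⊗ ∏ w₂₁
    E₂₂ = sc 1# ⊗ ∏ w₂₂

    scaled-product : ∀ k k' w w' → (sc k ⊗ ∏ w) ⊗ (sc k' ⊗ ∏ w') ≃ sc (k * k') ⊗ ∏ (w ++ w')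
    scaled-product k k' w w' = ~trans (⊗-assoc _ _ _) (~trans (⊗-cong ~refl (sc-pull k' _ _))
      (~trans (sc-⊗-sc _ _ _) (⊗-cong ~refl (~sym (∏-++ w w')))))

    product-to : ∀ {k k' m k''} w w' {w''} → ∏ (w ++ w') ≐ m ⊙ ∏ w'' → (k * k') * m ≈ k'' →
                 (sc k ⊗ ∏ w) ⊗ (sc k' ⊗ ∏ w') ≃ sc k'' ⊗ ∏ w''
    product-to {k} {k'} w w' p eq =
      ~trans (scaled-product k k' w w') (~trans (⊗-cong ~refl p) (~trans (sc-⊗-sc _ _ _) (sc-congˡ _ eq)))

    product-zero : ∀ {k k'} w w' → ∏ (w ++ w') ≃ sc 0# → (sc k ⊗ ∏ w) ⊗ (sc k' ⊗ ∏ w') ≃ sc 0#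
    product-zero {k} {k'} w w' p = ~trans (scaled-product k k' w w') (~trans (⊗-cong ~refl p) (⊗-zero _))

    -- the normalisations making E₁₂E₂₁ = E₁₁ and E₂₁E₁₂ = E₂₂
    κ·-t₂⁻¹·δ≈1 : (κ * (- t₂⁻¹)) * (1# * δ) ≈ 1#
    κ·-t₂⁻¹·δ≈1 = trans (solve 4 (λ k t a i → (k :* (:- i)) :* (𝟙 :* (a :+ (:- (t :* t)))) := k :* (i :* (t :* t) :+ (:- (i :* a)))) refl κ t₁ t₂ t₂⁻¹)
      (trans (*-congˡ (+-congˡ (-‿cong t₂⁻¹t₂≈1))) (trans (*-comm _ _) κ-inv))

    -t₂⁻¹·κ·δ≈1 : ((- t₂⁻¹) * κ) * (1# * δ) ≈ 1#
    -t₂⁻¹·κ·δ≈1 = trans (*-congʳ (*-comm _ _)) κ·-t₂⁻¹·δ≈1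

    E₁₁E₁₁ : E₁₁ ⊗ E₁₁ ≃ E₁₁
    E₁₁E₁₁ = product-to w₁₁ w₁₁ (∏-pair ee≐e) (solve 0 ((𝟙 :* 𝟙) :* 𝟙 := 𝟙) refl)
    E₁₁E₁₂ : E₁₁ ⊗ E₁₂ ≃ E₁₂
    E₁₁E₁₂ = product-to w₁₁ w₁₂ (∏-inside [] {e ∷ e ∷ []} {e ∷ []} (gU ∷ f ∷ []) (∏-pair ee≐e)) (solve 1 (λ k → (𝟙 :* k) :* 𝟙 := k) refl κ)
    E₁₁E₂₁ : E₁₁ ⊗ E₂₁ ≃ sc 0#
    E₁₁E₂₁ = product-zero w₁₁ w₂₁ (∏-inside-zero [] {e ∷ f ∷ []} (gU ∷ e ∷ []) (∏-pair-zero ef≃0))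
    E₁₁E₂₂ : E₁₁ ⊗ E₂₂ ≃ sc 0#
    E₁₁E₂₂ = product-zero w₁₁ w₂₂ (∏-pair-zero ef≃0)
    E₁₂E₁₁ : E₁₂ ⊗ E₁₁ ≃ sc 0#
    E₁₂E₁₁ = product-zero w₁₂ w₁₁ (∏-inside-zero (e ∷ gU ∷ []) {f ∷ e ∷ []} [] (∏-pair-zero fe≃0))
    E₁₂E₁₂ : E₁₂ ⊗ E₁₂ ≃ sc 0#
    E₁₂E₁₂ = product-zero w₁₂ w₁₂ (∏-inside-zero (e ∷ gU ∷ []) {f ∷ e ∷ []} (gU ∷ f ∷ []) (∏-pair-zero fe≃0))
    E₁₂E₂₁ : E₁₂ ⊗ E₂₁ ≃ E₁₁
    E₁₂E₂₁ = product-to w₁₂ w₂₁ (∏-inside (e ∷ gU ∷ []) {f ∷ f ∷ []} {f ∷ []} (gU ∷ e ∷ []) (∏-pair ff≐f) ▸ eUfUe≐δe) κ·-t₂⁻¹·δ≈1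
    E₁₂E₂₂ : E₁₂ ⊗ E₂₂ ≃ E₁₂
    E₁₂E₂₂ = product-to w₁₂ w₂₂ (∏-inside (e ∷ gU ∷ []) {f ∷ f ∷ []} {f ∷ []} [] (∏-pair ff≐f)) (solve 1 (λ k → (k :* 𝟙) :* 𝟙 := k) refl κ)
    E₂₁E₁₁ : E₂₁ ⊗ E₁₁ ≃ E₂₁
    E₂₁E₁₁ = product-to w₂₁ w₁₁ (∏-inside (f ∷ gU ∷ []) {e ∷ e ∷ []} {e ∷ []} [] (∏-pair ee≐e)) (solve 1 (λ i → ((:- i) :* 𝟙) :* 𝟙 := :- i) refl t₂⁻¹)
    E₂₁E₁₂ : E₂₁ ⊗ E₁₂ ≃ E₂₂
    E₂₁E₁₂ = product-to w₂₁ w₁₂ (∏-inside (f ∷ gU ∷ []) {e ∷ e ∷ []} {e ∷ []} (gU ∷ f ∷ []) (∏-pair ee≐e) ▸ fUeUf≐δf) -t₂⁻¹·κ·δ≈1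
    E₂₁E₂₁ : E₂₁ ⊗ E₂₁ ≃ sc 0#
    E₂₁E₂₁ = product-zero w₂₁ w₂₁ (∏-inside-zero (f ∷ gU ∷ []) {e ∷ f ∷ []} (gU ∷ e ∷ []) (∏-pair-zero ef≃0))
    E₂₁E₂₂ : E₂₁ ⊗ E₂₂ ≃ sc 0#
    E₂₁E₂₂ = product-zero w₂₁ w₂₂ (∏-inside-zero (f ∷ gU ∷ []) {e ∷ f ∷ []} [] (∏-pair-zero ef≃0))
    E₂₂E₁₁ : E₂₂ ⊗ E₁₁ ≃ sc 0#
    E₂₂E₁₁ = product-zero w₂₂ w₁₁ (∏-pair-zero fe≃0)
    E₂₂E₁₂ : E₂₂ ⊗ E₁₂ ≃ sc 0#
    E₂₂E₁₂ = product-zero w₂₂ w₁₂ (∏-inside-zero [] {f ∷ e ∷ []} (gU ∷ f ∷ []) (∏-pair-zero fe≃0))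
    E₂₂E₂₁ : E₂₂ ⊗ E₂₁ ≃ E₂₁
    E₂₂E₂₁ = product-to w₂₂ w₂₁ (∏-inside [] {f ∷ f ∷ []} {f ∷ []} (gU ∷ e ∷ []) (∏-pair ff≐f)) (solve 1 (λ i → (𝟙 :* (:- i)) :* 𝟙 := :- i) refl t₂⁻¹)
    E₂₂E₂₂ : E₂₂ ⊗ E₂₂ ≃ E₂₂
    E₂₂E₂₂ = product-to w₂₂ w₂₂ (∏-pair ff≐f) (solve 0 ((𝟙 :* 𝟙) :* 𝟙 := 𝟙) refl)

    fromMat : Mat θ → Tm
    fromMat (mat a b c' d) = sc a ⊗ E₁₁ ⊕ sc b ⊗ E₁₂ ⊕ sc c' ⊗ E₂₁ ⊕ sc d ⊗ E₂₂

    fromMat-cong : ∀ {A B} → A ≈M B → fromMat A ≃ fromMat B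
    fromMat-cong (p , q , r , s) =
      ⊕-cong (⊕-cong (⊕-cong (sc-congˡ _ p) (sc-congˡ _ q)) (sc-congˡ _ r)) (sc-congˡ _ s)

    ⊕-interchange : ∀ A B C D → (A ⊕ B) ⊕ (C ⊕ D) ≃ (A ⊕ C) ⊕ (B ⊕ D)
    ⊕-interchange A B C D = begin
      (A ⊕ B) ⊕ (C ⊕ D)  ≈⟨ ⊕-assoc _ _ _ ⟩
      A ⊕ (B ⊕ (C ⊕ D))  ≈⟨ ⊕-cong ~refl (~sym (⊕-assoc _ _ _)) ⟩
      A ⊕ ((B ⊕ C) ⊕ D)  ≈⟨ ⊕-cong ~refl (⊕-cong (⊕-comm _ _) ~refl) ⟩
      A ⊕ ((C ⊕ B) ⊕ D)  ≈⟨ ⊕-cong ~refl (⊕-assoc _ _ _) ⟩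
      A ⊕ (C ⊕ (B ⊕ D))  ≈⟨ ~sym (⊕-assoc _ _ _) ⟩
      (A ⊕ C) ⊕ (B ⊕ D)  ∎

    fromMat-+ : ∀ A B → fromMat A ⊕ fromMat B ≃ fromMat (A +M B)
    fromMat-+ (mat a b c' d) (mat a' b' c'' d') =
      ~trans (⊕-interchange _ _ _ _) (⊕-cong (~trans (⊕-interchange _ _ _ _) (⊕-cong (~trans (⊕-interchange _ _ _ _)
        (⊕-cong (sc-⊕-sc _ _ _) (sc-⊕-sc _ _ _))) (sc-⊕-sc _ _ _))) (sc-⊕-sc _ _ _))

    fromMat-scale : ∀ k A → sc k ⊗ fromMat A ≃ fromMat (scaleM k A)
    fromMat-scale k (mat a b c' d) =
      ~trans (~distribˡ _ _ _) (⊕-cong (~trans (~distribˡ _ _ _) (⊕-cong (~trans (~distribˡ _ _ _)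
        (⊕-cong (sc-⊗-sc _ _ _) (sc-⊗-sc _ _ _))) (sc-⊗-sc _ _ _))) (sc-⊗-sc _ _ _))

    left-multiply : ∀ X {P₁ P₂ P₃ P₄} a b c' d →
      X ⊗ E₁₁ ≃ P₁ → X ⊗ E₁₂ ≃ P₂ → X ⊗ E₂₁ ≃ P₃ → X ⊗ E₂₂ ≃ P₄ →
      X ⊗ fromMat (mat a b c' d) ≃ sc a ⊗ P₁ ⊕ sc b ⊗ P₂ ⊕ sc c' ⊗ P₃ ⊕ sc d ⊗ P₄
    left-multiply X a b c' d p₁ p₂ p₃ p₄ =
      ~trans (~distribˡ _ _ _) (⊕-cong (~trans (~distribˡ _ _ _) (⊕-cong (~trans (~distribˡ _ _ _)
        (⊕-cong (through p₁) (through p₂))) (through p₃))) (through p₄))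
      where
      through : ∀ {k E P} → X ⊗ E ≃ P → X ⊗ (sc k ⊗ E) ≃ sc k ⊗ P
      through {k} p = ~trans (sc-pull k _ _) (⊗-cong ~refl p)

    drop-last-two : ∀ {X Y Z Z'} → Z ≃ sc 0# → Z' ≃ sc 0# → X ⊕ Y ⊕ Z ⊕ Z' ≃ X ⊕ Y
    drop-last-two p p' = ~trans (⊕-cong (~trans (⊕-cong ~refl p) (⊕-idʳ _)) p') (⊕-idʳ _)

    drop-first-two : ∀ {X Y Z Z'} → Z ≃ sc 0# → Z' ≃ sc 0# → Z ⊕ Z' ⊕ X ⊕ Y ≃ X ⊕ Y
    drop-first-two p p' = ⊕-cong (~trans (⊕-cong (~trans (⊕-cong p p') (⊕-idʳ _)) ~refl) (⊕-idˡ _)) ~refl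

    E₁₁-row : ∀ a b c' d → E₁₁ ⊗ fromMat (mat a b c' d) ≃ fromMat (mat a b 0# 0#)
    E₁₁-row a b c' d = ~trans (left-multiply E₁₁ a b c' d E₁₁E₁₁ E₁₁E₁₂ E₁₁E₂₁ E₁₁E₂₂)
      (~trans (drop-last-two (⊗-zero _) (⊗-zero _)) (~sym (drop-last-two (zero-⊗ E₂₁) (zero-⊗ E₂₂))))
    E₁₂-row : ∀ a b c' d → E₁₂ ⊗ fromMat (mat a b c' d) ≃ fromMat (mat c' d 0# 0#)
    E₁₂-row a b c' d = ~trans (left-multiply E₁₂ a b c' d E₁₂E₁₁ E₁₂E₁₂ E₁₂E₂₁ E₁₂E₂₂)
      (~trans (drop-first-two (⊗-zero _) (⊗-zero _)) (~sym (drop-last-two (zero-⊗ E₂₁) (zero-⊗ E₂₂))))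
    E₂₁-row : ∀ a b c' d → E₂₁ ⊗ fromMat (mat a b c' d) ≃ fromMat (mat 0# 0# a b)
    E₂₁-row a b c' d = ~trans (left-multiply E₂₁ a b c' d E₂₁E₁₁ E₂₁E₁₂ E₂₁E₂₁ E₂₁E₂₂)
      (~trans (drop-last-two (⊗-zero _) (⊗-zero _)) (~sym (drop-first-two (zero-⊗ E₁₁) (zero-⊗ E₁₂))))
    E₂₂-row : ∀ a b c' d → E₂₂ ⊗ fromMat (mat a b c' d) ≃ fromMat (mat 0# 0# c' d)
    E₂₂-row a b c' d = ~trans (left-multiply E₂₂ a b c' d E₂₂E₁₁ E₂₂E₁₂ E₂₂E₂₁ E₂₂E₂₂)
      (~trans (drop-first-two (⊗-zero _) (⊗-zero _)) (~sym (drop-first-two (zero-⊗ E₁₁) (zero-⊗ E₁₂))))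

    scaled-row : ∀ k E B R → E ⊗ fromMat B ≃ fromMat R → (sc k ⊗ E) ⊗ fromMat B ≃ fromMat (scaleM k R)
    scaled-row k E B R p = ~trans (⊗-assoc _ _ _) (~trans (⊗-cong ~refl p) (fromMat-scale k R))

    -- fromMat is multiplicative: the E_ij multiply like matrix units
    fromMat-· : ∀ A B → fromMat A ⊗ fromMat B ≃ fromMat (A ·M B)
    fromMat-· (mat a b c' d) B@(mat a' b' c'' d') = begin
      fromMat (mat a b c' d) ⊗ fromMat B  ≈⟨ ~distribʳ _ _ _ ⟩
      _ ≈⟨ ⊕-cong (~distribʳ _ _ _) ~refl ⟩
      _ ≈⟨ ⊕-cong (⊕-cong (~distribʳ _ _ _) ~refl) ~refl ⟩
      _ ≈⟨ ⊕-cong (⊕-cong (⊕-cong (scaled-row a E₁₁ B R₁ (E₁₁-row a' b' c'' d')) (scaled-row b E₁₂ B R₂ (E₁₂-row a' b' c'' d')))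
                   (scaled-row c' E₂₁ B R₃ (E₂₁-row a' b' c'' d'))) (scaled-row d E₂₂ B R₄ (E₂₂-row a' b' c'' d')) ⟩
      _ ≈⟨ ⊕-cong (⊕-cong (fromMat-+ _ _) ~refl) ~refl ⟩
      _ ≈⟨ ⊕-cong (fromMat-+ _ _) ~refl ⟩
      _ ≈⟨ fromMat-+ _ _ ⟩
      fromMat (scaleM a R₁ +M scaleM b R₂ +M scaleM c' R₃ +M scaleM d R₄) ≈⟨ fromMat-cong row-expansion ⟩
      fromMat (mat a b c' d ·M B) ∎
      where
      R₁ = mat a' b' 0# 0#
      R₂ = mat c'' d' 0# 0#
      R₃ = mat 0# 0# a' b'
      R₄ = mat 0# 0# c'' d'
      row-expansion : scaleM a R₁ +M scaleM b R₂ +M scaleM c' R₃ +M scaleM d R₄ ≈M mat a b c' d ·M B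
      row-expansion = solveₘ 8 (λ a b c' d a' b' c'' d' →
        scaleₚ a (pmat a' b' 𝟘 𝟘) +ₚ scaleₚ b (pmat c'' d' 𝟘 𝟘) +ₚ scaleₚ c' (pmat 𝟘 𝟘 a' b') +ₚ scaleₚ d (pmat 𝟘 𝟘 c'' d')
          ⊜ pmat a b c' d ·ₚ pmat a' b' c'' d') ≈M-refl a b c' d a' b' c'' d'

    E₁₁≃e : E₁₁ ≃ e
    E₁₁≃e = ~trans (⊗-idˡ _) (⊗-idʳ e)

    E₂₂≃f : E₂₂ ≃ f
    E₂₂≃f = ~trans (⊗-idˡ _) (⊗-idʳ f)

    only-last : ∀ {X Y Z V} → X ≃ sc 0# → Y ≃ sc 0# → Z ≃ sc 0# → X ⊕ Y ⊕ Z ⊕ V ≃ V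
    only-last p q r = ~trans (⊕-cong (~trans (⊕-cong (~trans (⊕-cong p q) (⊕-idʳ _)) r) (⊕-idʳ _)) ~refl) (⊕-idˡ _)

    sc≃fromMat : ∀ k → sc k ≃ fromMat (scalarM k)
    sc≃fromMat k = begin
      sc k                                      ≈⟨ ~sym (⊗-idʳ _) ⟩
      sc k ⊗ sc 1#                              ≈⟨ ⊗-cong ~refl (~sym (~trans (⊕-cong E₁₁≃e E₂₂≃f) e⊕f≃1)) ⟩
      sc k ⊗ (E₁₁ ⊕ E₂₂)                        ≈⟨ ~distribˡ _ _ _ ⟩
      sc k ⊗ E₁₁ ⊕ sc k ⊗ E₂₂                   ≈⟨ ⊕-cong (~sym (~trans (⊕-cong ~refl (zero-⊗ E₁₂)) (⊕-idʳ _))) ~refl ⟩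
      sc k ⊗ E₁₁ ⊕ sc 0# ⊗ E₁₂ ⊕ sc k ⊗ E₂₂     ≈⟨ ⊕-cong (~sym (~trans (⊕-cong ~refl (zero-⊗ E₂₁)) (⊕-idʳ _))) ~refl ⟩
      fromMat (scalarM k)                       ∎

    S≃fromMat : gS ≃ fromMat (AS θ)
    S≃fromMat = ~sym (begin
      fromMat (AS θ)                 ≈⟨ only-last (zero-⊗ E₁₁) (zero-⊗ E₁₂) (zero-⊗ E₂₁) ⟩
      sc (- 1#) ⊗ E₂₂                ≈⟨ ⊗-cong ~refl E₂₂≃f ⟩
      sc (- 1#) ⊗ (sc (- 1#) ⊗ gS)   ≈⟨ sc-⊗-sc _ _ gS ⟩
      sc (- 1# * - 1#) ⊗ gS          ≈⟨ sc-congˡ gS (solve 0 (:- 𝟙 :* :- 𝟙 := 𝟙) refl) ⟩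
      sc 1# ⊗ gS                     ≈⟨ ⊗-idˡ gS ⟩
      gS                             ∎)

    as-entry : ∀ {X Y m a k} → X ≐ m ⊙ Y → a * k ≈ m → X ≃ sc a ⊗ (sc k ⊗ Y)
    as-entry {Y = Y} p eq = ~trans p (~trans (sc-congˡ Y (sym eq)) (~sym (sc-⊗-sc _ _ Y)))

    -- U = (e + f) U (e + f) = eUe + eUf + fUe + fUf
    U≃fromMat : gU ≃ fromMat (AU θ)
    U≃fromMat = begin
      gU                                      ≈⟨ ~sym (~trans (⊗-idˡ _) (~trans (⊗-cong ~refl (⊗-idˡ _)) (⊗-idʳ gU))) ⟩
      ∏ (sc 1# ∷ gU ∷ sc 1# ∷ [])             ≈⟨ ∏-cong-at [] (gU ∷ sc 1# ∷ []) (~sym e⊕f≃1) ⟩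
      ∏ ((e ⊕ f) ∷ gU ∷ sc 1# ∷ [])           ≈⟨ ∏-cong-at ((e ⊕ f) ∷ gU ∷ []) [] (~sym e⊕f≃1) ⟩
      ∏ ((e ⊕ f) ∷ gU ∷ (e ⊕ f) ∷ [])         ≈⟨ ∏-distrib-at [] (gU ∷ (e ⊕ f) ∷ []) ⟩
      _ ≈⟨ ⊕-cong (∏-distrib-at (e ∷ gU ∷ []) []) (∏-distrib-at (f ∷ gU ∷ []) []) ⟩
      (∏ (e ∷ gU ∷ e ∷ []) ⊕ ∏ w₁₂) ⊕ (∏ w₂₁ ⊕ ∏ (f ∷ gU ∷ f ∷ []))   ≈⟨ ~sym (⊕-assoc _ _ _) ⟩
      _ ≈⟨ ⊕-cong (⊕-cong (⊕-cong (as-entry eUe≐t₁e (*-identityʳ t₁)) (as-entry (≃⇒≐1 ~refl) κ-inv))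
                   (as-entry (≃⇒≐1 ~refl) (trans (solve 2 (λ a i → (:- a) :* (:- i) := a :* i) refl t₂ t₂⁻¹) t₂-inv)))
                   (as-entry fUf≐-t₁f (*-identityʳ (- t₁))) ⟩
      fromMat (AU θ)                          ∎

    -- U = U⁻¹ U U = t₂ U⁻¹, so U⁻¹ = t₂⁻¹ U
    U⁻¹≃fromMat : gU⁻¹ ≃ fromMat (AU⁻¹ θ)
    U⁻¹≃fromMat = begin
      gU⁻¹                                ≈⟨ ~sym (⊗-idˡ _) ⟩
      sc 1# ⊗ gU⁻¹                        ≈⟨ sc-congˡ _ (sym t₂⁻¹t₂≈1) ⟩
      sc (t₂⁻¹ * t₂) ⊗ gU⁻¹               ≈⟨ ~sym (sc-⊗-sc _ _ _) ⟩
      sc t₂⁻¹ ⊗ (sc t₂ ⊗ gU⁻¹)            ≈⟨ ⊗-cong ~refl (~sym U≃t₂U⁻¹) ⟩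
      sc t₂⁻¹ ⊗ gU                        ≈⟨ ⊗-cong ~refl U≃fromMat ⟩
      sc t₂⁻¹ ⊗ fromMat (AU θ)            ≈⟨ fromMat-scale _ _ ⟩
      fromMat (scaleM t₂⁻¹ (AU θ))        ≈⟨ fromMat-cong (refl , refl , -t₂⁻¹t₂≈-1 , solve 2 (λ t i → i :* (:- t) := :- (i :* t)) refl t₁ t₂⁻¹) ⟩
      fromMat (AU⁻¹ θ)                    ∎
      where
      U≃t₂U⁻¹ : gU ≃ sc t₂ ⊗ gU⁻¹
      U≃t₂U⁻¹ = begin
        gU                     ≈⟨ ~sym (⊗-idˡ _) ⟩
        sc 1# ⊗ gU             ≈⟨ ⊗-cong (~sym U⁻¹U) ~refl ⟩
        (gU⁻¹ ⊗ gU) ⊗ gU       ≈⟨ ⊗-assoc _ _ _ ⟩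
        gU⁻¹ ⊗ ζ₂              ≈⟨ ⊗-cong ~refl θζ₂ ⟩
        gU⁻¹ ⊗ sc t₂           ≈⟨ ~sym (sc-central _ _) ⟩
        sc t₂ ⊗ gU⁻¹           ∎
      -t₂⁻¹t₂≈-1 : t₂⁻¹ * (- t₂) ≈ - 1#
      -t₂⁻¹t₂≈-1 = trans (solve 2 (λ a i → i :* (:- a) := :- (a :* i)) refl t₂ t₂⁻¹) (-‿cong t₂-inv)

    ≃fromMat𝒜 : ∀ x → x ≃ fromMat (𝒜 θ x)
    ≃fromMat𝒜 gS = S≃fromMat
    ≃fromMat𝒜 gU = U≃fromMat
    ≃fromMat𝒜 gU⁻¹ = U⁻¹≃fromMat
    ≃fromMat𝒜 (sc k) = sc≃fromMat k
    ≃fromMat𝒜 (x ⊕ y) = ~trans (⊕-cong (≃fromMat𝒜 x) (≃fromMat𝒜 y)) (fromMat-+ (𝒜 θ x) (𝒜 θ y))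
    ≃fromMat𝒜 (x ⊗ y) = ~trans (⊗-cong (≃fromMat𝒜 x) (≃fromMat𝒜 y)) (fromMat-· (𝒜 θ x) (𝒜 θ y))

    faithful : Faithful θ
    faithful x y p = ~trans (≃fromMat𝒜 x) (~trans (fromMat-cong p) (~sym (≃fromMat𝒜 y)))

    𝒜E₁₁ : 𝒜 θ E₁₁ ≈M mat 1# 0# 0# 0#
    𝒜E₁₁ = solveₘ 0 (let s = pmat 𝟘 𝟘 𝟘 (:- 𝟙) in
      scalarₚ 𝟙 ·ₚ ((scalarₚ 𝟙 +ₚ s) ·ₚ scalarₚ 𝟙) ⊜ pmat 𝟙 𝟘 𝟘 𝟘) ≈M-refl
    𝒜E₂₂ : 𝒜 θ E₂₂ ≈M mat 0# 0# 0# 1#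
    𝒜E₂₂ = solveₘ 0 (let s = pmat 𝟘 𝟘 𝟘 (:- 𝟙) in
      scalarₚ 𝟙 ·ₚ ((scalarₚ (:- 𝟙) ·ₚ s) ·ₚ scalarₚ 𝟙) ⊜ pmat 𝟘 𝟘 𝟘 𝟙) ≈M-refl
    𝒜E₁₂ : 𝒜 θ E₁₂ ≈M mat 0# 1# 0# 0#
    𝒜E₁₂ = ≈M-trans (solveₘ 4 (λ k t b a → let s = pmat 𝟘 𝟘 𝟘 (:- 𝟙); u = pmat t b (:- a) (:- t) in
      scalarₚ k ·ₚ ((scalarₚ 𝟙 +ₚ s) ·ₚ (u ·ₚ ((scalarₚ (:- 𝟙) ·ₚ s) ·ₚ scalarₚ 𝟙))) ⊜ pmat 𝟘 (b :* k) 𝟘 𝟘)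
        ≈M-refl κ t₁ b𝒜 t₂) (refl , κ-inv , refl , refl)
    𝒜E₂₁ : 𝒜 θ E₂₁ ≈M mat 0# 0# 1# 0#
    𝒜E₂₁ = ≈M-trans (solveₘ 4 (λ i t b a → let s = pmat 𝟘 𝟘 𝟘 (:- 𝟙); u = pmat t b (:- a) (:- t) in
      scalarₚ (:- i) ·ₚ ((scalarₚ (:- 𝟙) ·ₚ s) ·ₚ (u ·ₚ ((scalarₚ 𝟙 +ₚ s) ·ₚ scalarₚ 𝟙))) ⊜ pmat 𝟘 𝟘 (i :* a) 𝟘)
        ≈M-refl t₂⁻¹ t₁ b𝒜 t₂) (refl , refl , t₂⁻¹t₂≈1 , refl)

    surjective : ∀ (M : Mat θ) → ∃ λ x → 𝒜 θ x ≈M M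
    surjective (mat a b c' d) = fromMat (mat a b c' d) ,
      ≈M-trans (+M-cong (+M-cong (+M-cong (·M-cong ≈M-refl 𝒜E₁₁) (·M-cong ≈M-refl 𝒜E₁₂))
                                 (·M-cong ≈M-refl 𝒜E₂₁)) (·M-cong ≈M-refl 𝒜E₂₂))
        (solveₘ 4 (λ a b c' d → scalarₚ a ·ₚ pmat 𝟙 𝟘 𝟘 𝟘 +ₚ scalarₚ b ·ₚ pmat 𝟘 𝟙 𝟘 𝟘
                                +ₚ scalarₚ c' ·ₚ pmat 𝟘 𝟘 𝟙 𝟘 +ₚ scalarₚ d ·ₚ pmat 𝟘 𝟘 𝟘 𝟙 ⊜ pmat a b c' d)
          ≈M-refl a b c' d)

mainTheorem4 : ∀ {c ℓ} (K : Field c ℓ) (q : ℕ) → IsAlgClosureOfFq K q →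
    (θ : Hecke.Character K) →
    let open Field K
        open Hecke.Character θ
    in (Hecke.Faithful K θ ⇔ (¬ (t₁ * t₁ ≈ t₂)))
       × ((¬ (t₁ * t₁ ≈ t₂)) → Hecke.IsAlgebraIso K θ)
mainTheorem4 K q _ θ =
  mk⇔ (λ faithful t₁²≈t₂ → not-faithful t₁²≈t₂ faithful) (λ t₁²≉t₂ → faithful (κ t₁²≉t₂) (κ-inv t₁²≉t₂))
  , λ t₁²≉t₂ → 𝒜-respects , faithful (κ t₁²≉t₂) (κ-inv t₁²≉t₂) , surjective (κ t₁²≉t₂) (κ-inv t₁²≉t₂)
  where
  open Field K
  open Hecke.Character θ
  open Representations K θ using (b𝒜; b𝒜≈0⇒t₁²≈t₂; not-faithful; 𝒜-respects)
  open MatrixUnits K θ using (faithful; surjective)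
  b𝒜-invertible : ¬ (t₁ * t₁ ≈ t₂) → ∃ λ κ → b𝒜 * κ ≈ 1#
  b𝒜-invertible t₁²≉t₂ = inverse b𝒜 (λ b𝒜≈0 → t₁²≉t₂ (b𝒜≈0⇒t₁²≈t₂ b𝒜≈0))
  κ : ¬ (t₁ * t₁ ≈ t₂) → Carrier
  κ t₁²≉t₂ = proj₁ (b𝒜-invertible t₁²≉t₂)
  κ-inv : ∀ t₁²≉t₂ → b𝒜 * κ t₁²≉t₂ ≈ 1#
  κ-inv t₁²≉t₂ = proj₂ (b𝒜-invertible t₁²≉t₂)
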